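{- Let $G=(V,E)$ be a graph whose edges are written as ordered pairs $\langle v_j,v_l\rangle$, let $S\subseteq V$ be a terminal set, $r\in S$ a root, $c:E\to\mathbb{Z}^{+}$ a cost function, $d:E\to\mathbb{Z}^{+}$ a delay function, and $D\in\mathbb{Z}^{+}$ a delay bound. Let $H$ be the auxiliary directed graph with terminal set $S_H$ constructed from these data as described in the context. Then every minimum cost directed Steiner tree in $H$ rooted at $r$ and spanning $S_H$ contains, for each vertex $v_l\in V\setminus\{r\}$, at most one vertex of the set $\{v_l^{1},\dots,v_l^{D}\}$.
   Context: Construction of the auxiliary directed graph $H$ and its terminal set $S_H$: $H$ contains the vertex $r$, and $S_H$ initially equals $\{r\}$. For each $v_l\in V\setminus\{r\}$, $H$ contains $D$ vertices $v_l^{1},\dots,v_l^{D}$ (copies of $v_l$); if moreover $v_l\in S$, then $H$ also contains an additional vertex (also denoted $v_l$), which is added to $S_H$, together with arcs $\langle v_l^{i},v_l\rangle$ of cost $0$ for $i=1,\dots,D$. For each edge $e=\langle v_j,v_l\rangle\in E$ with $r\notin e$, $H$ contains the arcs $\langle v_j^{i},v_l^{d(e)+i}\rangle$ for $i=1,\dots,D-d(e)$, each of cost $c(e)$. For each edge $e=\langle r,v_l\rangle\in E$, $H$ contains the arc $\langle r,v_l^{d(e)}\rangle$ of cost $c(e)$ (when $d(e)\le D$). A directed Steiner tree in $H$ rooted at $r$ spanning $S_H$ is an out-arborescence in $H$ rooted at $r$ containing all vertices of $S_H$; its cost is the sum of the costs of its arcs. -}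

module Defs where

open import Data.Nat using (ℕ; _+_; _∸_; _≤_)
open import Data.Fin using (Fin)
open import Data.Fin.Subset using (Subset) renaming (_∈_ to _∈ₛ_)
open import Data.Product using (_×_; proj₁; proj₂; ∃-syntax)
open import Data.Sum using (_⊎_)
open import Data.List using (List; map)
open import Data.Nat.ListAction using (sum)
open import Data.List.Membership.Propositional using (_∈_)
open import Data.List.Relation.Unary.All using (All)
open import Data.List.Relation.Unary.Unique.Propositional using (Unique)
open import Relation.Binary.PropositionalEquality using (_≡_; _≢_)

record Instance : Set where
  field
    n    : ℕ
    m    : ℕ
    edge : Fin m → Fin n × Fin n
    S    : Subset n
    r    : Fin n
    c    : Fin m → ℕ
    d    : Fin m → ℕ
    D    : ℕ

-- Vertices of H:  root = r,  copy v i = v^i,  term v = the extra terminal vertex v.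
data HV (n : ℕ) : Set where
  root : HV n
  copy : Fin n → ℕ → HV n
  term : Fin n → HV n

-- Arc names of H (validity is a separate predicate):
--   toTerm v i  : ⟨v^i , v⟩              (v ∈ S, v ≠ r, 1 ≤ i ≤ D), cost 0
--   mid e i     : ⟨v_j^i , v_l^(d(e)+i)⟩  (e = ⟨v_j,v_l⟩, r ∉ e, 1 ≤ i ≤ D - d(e)), cost c(e)
--   fromRoot e  : ⟨r , v_l^(d(e))⟩        (e = ⟨r,v_l⟩, d(e) ≤ D), cost c(e)
data HArc (m n : ℕ) : Set where
  toTerm   : Fin n → ℕ → HArc m n
  mid      : Fin m → ℕ → HArc m n
  fromRoot : Fin m → HArc m n

module _ (I : Instance) where
  open Instance I

  src tgt : Fin m → Fin n
  src e = proj₁ (edge e)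
  tgt e = proj₂ (edge e)

  ValidArc : HArc m n → Set
  ValidArc (toTerm v i) = (v ∈ₛ S) × (v ≢ r) × (1 ≤ i) × (i ≤ D)
  ValidArc (mid e i)    = (src e ≢ r) × (tgt e ≢ r) × (1 ≤ i) × (i ≤ D ∸ d e)
  ValidArc (fromRoot e) = (src e ≡ r) × (tgt e ≢ r) × (d e ≤ D)

  tailV : HArc m n → HV n
  tailV (toTerm v i) = copy v i
  tailV (mid e i)    = copy (src e) i
  tailV (fromRoot e) = root

  headV : HArc m n → HV n
  headV (toTerm v i) = term v
  headV (mid e i)    = copy (tgt e) (d e + i)
  headV (fromRoot e) = copy (tgt e) (d e)

  arcCost : HArc m n → ℕ
  arcCost (toTerm v i) = 0
  arcCost (mid e i)    = c e
  arcCost (fromRoot e) = c e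

  treeCost : List (HArc m n) → ℕ
  treeCost T = sum (map arcCost T)

  data Reach (T : List (HArc m n)) : HV n → Set where
    atRoot : Reach T root
    step   : ∀ {a} → a ∈ T → Reach T (tailV a) → Reach T (headV a)

  InTree : List (HArc m n) → HV n → Set
  InTree T x = (x ≡ root) ⊎ (∃[ a ] ((a ∈ T) × (headV a ≡ x)))

  IsDST : List (HArc m n) → Set
  IsDST T =
      Unique T
    × All ValidArc T
    × (∀ {a} → a ∈ T → headV a ≢ root)
    × (∀ {a b} → a ∈ T → b ∈ T → headV a ≡ headV b → a ≡ b)
    × (∀ {a} → a ∈ T → Reach T (tailV a))
    × (∀ v → v ∈ₛ S → v ≢ r → InTree T (term v))

  IsMinDST : List (HArc m n) → Set
  IsMinDST T = IsDST T × (∀ T' → IsDST T' → treeCost T ≤ treeCost T')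

module Submission where

-- Suppose a minimum tree T contains copies v^i and v^j with i < j, the pair chosen with j maximal
-- (downward induction from D). Delete the arc entering v^j, whose cost is positive, and lower every
-- copy w^k in the subtree below v^j to w^(k − (j − i)), so that the subtree now hangs from v^i:
-- lowering both endpoints of an arc of H by the same amount gives again an arc of H of the same
-- cost, and terminal vertices stay where they are. By the maximality of j no lowered copy was
-- already in T, so the result is still a Steiner tree, and it is cheaper than T.

open import Defs
open import Data.Nat using (ℕ; _≤_)
open import Data.Fin using (Fin)
open import Data.Fin.Subset using () renaming (_∈_ to _∈ₛ_)
open import Data.List using (List)
open import Relation.Binary.PropositionalEquality using (_≡_; _≢_)

open import Level using (Level)
open import Data.Bool using (Bool; true; false; if_then_else_)
open import Data.Bool.Properties using (¬-not)
open import Data.Nat using (zero; suc; _+_; _∸_; _<_; _≟_)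
open import Data.Nat.Properties
open import Data.Nat.ListAction using (sum)
import Data.Fin as Fin
open import Data.List using ([]; _∷_; map; filter)
open import Data.List.Membership.Propositional using (_∈_; mapWith∈)
open import Data.List.Membership.Propositional.Properties
  using (∈-filter⁺; ∈-filter⁻; map-mapWith∈; mapWith∈-cong; mapWith∈≗map)
open import Data.List.Relation.Unary.Any using (here; there)
open import Data.List.Relation.Unary.Any.Properties using (mapWith∈⁺; mapWith∈⁻)
import Data.List.Relation.Unary.All as All
open import Data.List.Relation.Unary.AllPairs using ([]; _∷_)
open import Data.List.Relation.Unary.Unique.Propositional using (Unique)
open import Data.List.Relation.Unary.Unique.Propositional.Properties using (filter⁺)
open import Data.Product using (∃-syntax; Σ-syntax; _×_; _,_; proj₁; proj₂)
open import Data.Sum using (_⊎_; inj₁; inj₂)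
open import Data.Empty using (⊥-elim)
open import Function using (_∘_)
open import Relation.Nullary using (¬_; yes; no; does)
open import Relation.Unary using (Pred; Decidable)
open import Relation.Binary using (DecidableEquality; tri<; tri≈; tri>)
open import Relation.Unary.Properties using (∁?)
open import Algebra.Properties.CommutativeSemigroup +-commutativeSemigroup using (x∙yz≈y∙xz)
open import Relation.Binary.PropositionalEquality using (refl; sym; trans; cong; subst; module ≡-Reasoning)

private
  variable
    ℓ₁ ℓ₂ : Level
    A B : Set ℓ₁

sum-map-filter : {P : Pred A ℓ₂} (P? : Decidable P) (f : A → ℕ) (xs : List A) →
                 sum (map f xs) ≡ sum (map f (filter P? xs)) + sum (map f (filter (∁? P?) xs))
sum-map-filter P? f [] = refl
sum-map-filter P? f (x ∷ xs) with does (P? x)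
... | true  = trans (cong (f x +_) (sum-map-filter P? f xs)) (sym (+-assoc (f x) _ _))
... | false = trans (cong (f x +_) (sum-map-filter P? f xs))
                    (x∙yz≈y∙xz (f x) (sum (map f (filter P? xs))) (sum (map f (filter (∁? P?) xs))))

∈⇒≤sum-map : (f : A → ℕ) {x : A} {xs : List A} → x ∈ xs → f x ≤ sum (map f xs)
∈⇒≤sum-map f (here refl) = m≤m+n _ _
∈⇒≤sum-map f {xs = y ∷ _} (there x∈xs) = ≤-trans (∈⇒≤sum-map f x∈xs) (m≤n+m _ (f y))

mapWith∈-unique : (xs : List A) (f : ∀ {x} → x ∈ xs → B) →
                  (∀ {x y} (p : x ∈ xs) (q : y ∈ xs) → f p ≡ f q → x ≡ y) →
                  Unique xs → Unique (mapWith∈ xs f)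
mapWith∈-unique [] f f-inj [] = []
mapWith∈-unique (x ∷ xs) f f-inj (x∉xs ∷ xs!) =
  All.tabulate fresh ∷ mapWith∈-unique xs (f ∘ there) (λ p q → f-inj (there p) (there q)) xs!
  where
  fresh : ∀ {z} → z ∈ mapWith∈ xs (f ∘ there) → f (here refl) ≢ z
  fresh z∈ f≡z with mapWith∈⁻ xs (f ∘ there) z∈
  ... | y , y∈xs , z≡fy = All.lookup x∉xs y∈xs (f-inj (here refl) (there y∈xs) (trans f≡z z≡fy))

module _ {n : ℕ} where

  copy-injective : ∀ {u u′ : Fin n} {k k′} → copy u k ≡ copy u′ k′ → u ≡ u′ × k ≡ k′
  copy-injective refl = refl , refl

  _≟ᵥ_ : DecidableEquality (HV n)
  root     ≟ᵥ root       = yes refl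
  copy u k ≟ᵥ copy u′ k′ with u Fin.≟ u′ | k ≟ k′
  ... | yes refl | yes refl = yes refl
  ... | no u≢u′  | _        = no (u≢u′ ∘ proj₁ ∘ copy-injective)
  ... | yes _    | no k≢k′  = no (k≢k′ ∘ proj₂ ∘ copy-injective)
  term u   ≟ᵥ term u′ with u Fin.≟ u′
  ... | yes refl = yes refl
  ... | no u≢u′  = no λ { refl → u≢u′ refl }
  root     ≟ᵥ copy _ _ = no λ ()
  root     ≟ᵥ term _   = no λ ()
  copy _ _ ≟ᵥ root     = no λ ()
  copy _ _ ≟ᵥ term _   = no λ ()
  term _   ≟ᵥ root     = no λ ()
  term _   ≟ᵥ copy _ _ = no λ ()

  data _≤level_ (j : ℕ) : HV n → Set where
    atCopy : ∀ {u k} → j ≤ k → j ≤level copy u k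
    atTerm : ∀ {u} → j ≤level term u

  ≤level-weaken : ∀ {j j′ x} → j ≤ j′ → j′ ≤level x → j ≤level x
  ≤level-weaken j≤j′ (atCopy j′≤k) = atCopy (≤-trans j≤j′ j′≤k)
  ≤level-weaken j≤j′ atTerm        = atTerm

  ≡-or-above⇒≤level : ∀ {v j x} → x ≡ copy v j ⊎ suc j ≤level x → j ≤level x
  ≡-or-above⇒≤level (inj₁ refl)  = atCopy ≤-refl
  ≡-or-above⇒≤level (inj₂ above) = ≤level-weaken (n≤1+n _) above

  shiftV : ℕ → HV n → HV n
  shiftV K root       = root
  shiftV K (copy u k) = copy u (k ∸ K)
  shiftV K (term u)   = term u

  shiftV-root : ∀ {K} x → shiftV K x ≡ root → x ≡ root
  shiftV-root root       _  = refl
  shiftV-root (copy _ _) ()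
  shiftV-root (term _)   ()

  shiftV-injective : ∀ {K x y} → K ≤level x → K ≤level y → shiftV K x ≡ shiftV K y → x ≡ y
  shiftV-injective (atCopy K≤k) (atCopy K≤k′) eq with copy-injective eq
  ... | refl , k∸K≡k′∸K = cong (copy _) (∸-cancelʳ-≡ K≤k K≤k′ k∸K≡k′∸K)
  shiftV-injective atTerm atTerm eq = eq

shiftA : ∀ {m n} → ℕ → HArc m n → HArc m n
shiftA K (toTerm u k) = toTerm u (k ∸ K)
shiftA K (mid e k)    = mid e (k ∸ K)
shiftA K (fromRoot e) = fromRoot e

module _ (I : Instance) where
  open Instance I

  private
    Arc : Set
    Arc = HArc m n

  tailV-shiftA : ∀ {K} a → tailV I (shiftA K a) ≡ shiftV K (tailV I a)
  tailV-shiftA (toTerm _ _) = refl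
  tailV-shiftA (mid _ _)    = refl
  tailV-shiftA (fromRoot _) = refl

  headV-shiftA : ∀ {K} a → K ≤level tailV I a → headV I (shiftA K a) ≡ shiftV K (headV I a)
  headV-shiftA (toTerm _ _) _            = refl
  headV-shiftA (mid e _)    (atCopy K≤k) = cong (copy (tgt I e)) (sym (+-∸-assoc (d e) K≤k))

  arcCost-shiftA : ∀ {K} a → arcCost I (shiftA K a) ≡ arcCost I a
  arcCost-shiftA (toTerm _ _) = refl
  arcCost-shiftA (mid _ _)    = refl
  arcCost-shiftA (fromRoot _) = refl

  validArc-shiftA : ∀ {K} a → suc K ≤level tailV I a → ValidArc I a → ValidArc I (shiftA K a)
  validArc-shiftA {K} (toTerm _ k) (atCopy K<k) (u∈S , u≢r , _ , k≤D) =
    u∈S , u≢r , m<n⇒0<n∸m K<k , ≤-trans (m∸n≤m k K) k≤D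
  validArc-shiftA {K} (mid _ k)    (atCopy K<k) (src≢r , tgt≢r , _ , k≤D∸d) =
    src≢r , tgt≢r , m<n⇒0<n∸m K<k , ≤-trans (m∸n≤m k K) k≤D∸d

  arcCost-positive : (∀ e → 1 ≤ c e) → ∀ {u k} a → headV I a ≡ copy u k → 1 ≤ arcCost I a
  arcCost-positive c-positive (mid e _)    _ = c-positive e
  arcCost-positive c-positive (fromRoot e) _ = c-positive e

  module _ (d-positive : ∀ e → 1 ≤ d e) where

    headV-≤level : ∀ {j} a → j ≤level tailV I a → suc j ≤level headV I a
    headV-≤level (toTerm _ _) _            = atTerm
    headV-≤level (mid e _)    (atCopy j≤k) = atCopy (+-mono-≤ (d-positive e) j≤k)

    validArc-headV-index : ∀ {u k} a → ValidArc I a → headV I a ≡ copy u k → 1 ≤ k × k ≤ D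
    validArc-headV-index (mid e k₀) (_ , _ , 1≤k₀ , k₀≤D∸d) refl =
      ≤-trans (d-positive e) (m≤m+n (d e) k₀) ,
      ≤-trans (≤-reflexive (+-comm (d e) k₀)) (m≤o∸n⇒m+n≤o k₀ (<⇒≤ d<D) k₀≤D∸d)
      where
      d<D : d e < D
      d<D = m∸n≢0⇒n<m λ D∸d≡0 → <-irrefl refl (≤-trans 1≤k₀ (≤-trans k₀≤D∸d (≤-reflexive D∸d≡0)))
    validArc-headV-index (fromRoot e) (_ , _ , d≤D) refl = d-positive e , d≤D

    inTree-copy-index : ∀ {T u k} → All.All (ValidArc I) T → InTree I T (copy u k) → 1 ≤ k × k ≤ D
    inTree-copy-index valid (inj₂ (a , a∈T , a↦uᵏ)) = validArc-headV-index a (All.lookup valid a∈T) a↦uᵏ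

  inTree⇒reach : ∀ {T x} → (∀ {a} → a ∈ T → Reach I T (tailV I a)) → InTree I T x → Reach I T x
  inTree⇒reach _         (inj₁ refl)              = atRoot
  inTree⇒reach reachable (inj₂ (a , a∈T , refl)) = step a∈T (reachable a∈T)

  reach⇒inTree : ∀ {T x} → Reach I T x → InTree I T x
  reach⇒inTree atRoot       = inj₁ refl
  reach⇒inTree (step a∈T _) = inj₂ (_ , a∈T , refl)

  Duplicated : List Arc → ℕ → Set
  Duplicated T k = ∃[ u ] ∃[ k₀ ] (k₀ < k × InTree I T (copy u k₀) × InTree I T (copy u k))

  FreeAbove : List Arc → ℕ → Set
  FreeAbove T j = ∀ {k} → j < k → ¬ Duplicated T k

  module _ {T : List Arc} (t : HV n) where

    visits : ∀ {x} → Reach I T x → Bool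
    visits atRoot = false
    visits (step {a} _ ρ) with headV I a ≟ᵥ t
    ... | yes _ = true
    ... | no _  = visits ρ

    visits-irrelevant : (∀ {a} → a ∈ T → headV I a ≢ root) →
                        (∀ {a b} → a ∈ T → b ∈ T → headV I a ≡ headV I b → a ≡ b) →
                        ∀ {x y} (ρ : Reach I T x) (σ : Reach I T y) → x ≡ y → visits ρ ≡ visits σ
    visits-irrelevant _        _              atRoot        atRoot        _   = refl
    visits-irrelevant head≢root _             atRoot        (step b∈T _)  x≡y = ⊥-elim (head≢root b∈T (sym x≡y))
    visits-irrelevant head≢root _             (step a∈T _)  atRoot        x≡y = ⊥-elim (head≢root a∈T x≡y)
    visits-irrelevant head≢root head-injective (step {a} a∈T ρ) (step b∈T σ) x≡y
      with head-injective a∈T b∈T x≡y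
    ... | refl with headV I a ≟ᵥ t
    ...   | yes _ = refl
    ...   | no _  = visits-irrelevant head≢root head-injective ρ σ refl

  visits-copy : (∀ e → 1 ≤ d e) → ∀ {T v j x} (ρ : Reach I T x) →
                visits (copy v j) ρ ≡ true → x ≡ copy v j ⊎ suc j ≤level x
  visits-copy d-positive atRoot ()
  visits-copy d-positive {v = v} {j} (step {a} _ ρ) vis with headV I a ≟ᵥ copy v j
  ... | yes a↦vʲ = inj₁ a↦vʲ
  ... | no _     = inj₂ (headV-≤level d-positive a (≡-or-above⇒≤level (visits-copy d-positive ρ vis)))

  module Exchange
    (c-positive : ∀ e → 1 ≤ c e) (d-positive : ∀ e → 1 ≤ d e)
    {T : List Arc}
    (T! : Unique T)
    (valid : All.All (ValidArc I) T)
    (head≢root : ∀ {a} → a ∈ T → headV I a ≢ root)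
    (head-injective : ∀ {a b} → a ∈ T → b ∈ T → headV I a ≡ headV I b → a ≡ b)
    (reachable : ∀ {a} → a ∈ T → Reach I T (tailV I a))
    (spanning : ∀ u → u ∈ₛ S → u ≢ r → InTree I T (term u))
    {v : Fin n} {i j : ℕ} (i<j : i < j) (vⁱ∈T : InTree I T (copy v i))
    {b : Arc} (b∈T : b ∈ T) (b↦vʲ : headV I b ≡ copy v j)
    (free : FreeAbove T j)
    where

    t : HV n
    t = copy v j

    K : ℕ
    K = j ∸ i

    K<j : K < j
    K<j = ∸-monoʳ-< {j} {i} {0} (proj₁ (inTree-copy-index d-positive valid vⁱ∈T)) (<⇒≤ i<j)

    relocate : Bool → HV n → HV n
    relocate moved x = if moved then shiftV K x else x

    reroute : (a : Arc) → Reach I T (tailV I a) → Arc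
    reroute a ρ = if visits t ρ then shiftA K a else a

    visited-tail-level : ∀ {a} (ρ : Reach I T (tailV I a)) → visits t ρ ≡ true → suc K ≤level tailV I a
    visited-tail-level ρ vis = ≤level-weaken K<j (≡-or-above⇒≤level (visits-copy d-positive ρ vis))

    visited-head-level : ∀ {a} (ρ : Reach I T (tailV I a)) → visits t ρ ≡ true → suc j ≤level headV I a
    visited-head-level {a} ρ vis = headV-≤level d-positive a (≡-or-above⇒≤level (visits-copy d-positive ρ vis))

    reroute-irrelevant : ∀ {a} (ρ σ : Reach I T (tailV I a)) → reroute a ρ ≡ reroute a σ
    reroute-irrelevant {a} ρ σ =
      cong (λ moved → if moved then shiftA K a else a) (visits-irrelevant t head≢root head-injective ρ σ refl)

    reroute-unvisited : ∀ {a} (ρ : Reach I T (tailV I a)) → visits t ρ ≡ false → reroute a ρ ≡ a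
    reroute-unvisited {a} ρ unvisited = cong (λ moved → if moved then shiftA K a else a) unvisited

    tailV-reroute : ∀ a (ρ : Reach I T (tailV I a)) → tailV I (reroute a ρ) ≡ relocate (visits t ρ) (tailV I a)
    tailV-reroute a ρ with visits t ρ
    ... | true  = tailV-shiftA a
    ... | false = refl

    headV-reroute : ∀ a (ρ : Reach I T (tailV I a)) → headV I (reroute a ρ) ≡ relocate (visits t ρ) (headV I a)
    headV-reroute a ρ with visits t ρ in vis
    ... | true  = headV-shiftA a (≤level-weaken (n≤1+n K) (visited-tail-level ρ vis))
    ... | false = refl

    arcCost-reroute : ∀ a (ρ : Reach I T (tailV I a)) → arcCost I (reroute a ρ) ≡ arcCost I a
    arcCost-reroute a ρ with visits t ρ
    ... | true  = arcCost-shiftA a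
    ... | false = refl

    validArc-reroute : ∀ {a} → a ∈ T → (ρ : Reach I T (tailV I a)) → ValidArc I (reroute a ρ)
    validArc-reroute {a} a∈T ρ with visits t ρ in vis
    ... | true  = validArc-shiftA a (visited-tail-level ρ vis) (All.lookup valid a∈T)
    ... | false = All.lookup valid a∈T

    shift-collision : ∀ {x y} → suc j ≤level x → Reach I T x → Reach I T y → shiftV K x ≡ y → x ≡ y
    shift-collision atTerm _ _ refl = refl
    shift-collision (atCopy {u} {k} j<k) uᵏ-reached uᵏ⁻ᴷ-reached refl =
      ⊥-elim (free j<k (u , k ∸ K , k∸K<k , reach⇒inTree uᵏ⁻ᴷ-reached , reach⇒inTree uᵏ-reached))
      where
      k∸K<k : k ∸ K < k
      k∸K<k = ∸-monoʳ-< {k} {K} {0} (m<n⇒0<n∸m i<j) (≤-trans (m∸n≤m j i) (<⇒≤ j<k))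

    relocated-heads-injective : ∀ {a a′} → a ∈ T → a′ ∈ T →
      (ρ : Reach I T (tailV I a)) (σ : Reach I T (tailV I a′)) →
      relocate (visits t ρ) (headV I a) ≡ relocate (visits t σ) (headV I a′) → headV I a ≡ headV I a′
    relocated-heads-injective a∈T a′∈T ρ σ eq with visits t ρ in visρ | visits t σ in visσ
    ... | true  | true  = shiftV-injective (K-level (visited-head-level ρ visρ)) (K-level (visited-head-level σ visσ)) eq
      where
      K-level : ∀ {x} → suc j ≤level x → K ≤level x
      K-level = ≤level-weaken (≤-trans (<⇒≤ K<j) (n≤1+n j))
    ... | true  | false = shift-collision (visited-head-level ρ visρ) (step a∈T ρ) (step a′∈T σ) eq
    ... | false | true  = sym (shift-collision (visited-head-level σ visσ) (step a′∈T σ) (step a∈T ρ) (sym eq))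
    ... | false | false = eq

    reroute-injective : ∀ {a a′} → a ∈ T → a′ ∈ T →
      (ρ : Reach I T (tailV I a)) (σ : Reach I T (tailV I a′)) →
      headV I (reroute a ρ) ≡ headV I (reroute a′ σ) → a ≡ a′
    reroute-injective {a} {a′} a∈T a′∈T ρ σ eq = head-injective a∈T a′∈T (relocated-heads-injective a∈T a′∈T ρ σ (begin
      relocate (visits t ρ) (headV I a)   ≡⟨ headV-reroute a ρ ⟨
      headV I (reroute a ρ)               ≡⟨ eq ⟩
      headV I (reroute a′ σ)              ≡⟨ headV-reroute a′ σ ⟩
      relocate (visits t σ) (headV I a′)  ∎))
      where open ≡-Reasoning

    intoTarget? : Decidable (λ a → headV I a ≡ t)
    intoTarget? a = headV I a ≟ᵥ t

    kept : List Arc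
    kept = filter (∁? intoTarget?) T

    kept⊆T : ∀ {a} → a ∈ kept → a ∈ T
    kept⊆T = proj₁ ∘ ∈-filter⁻ (∁? intoTarget?)

    T′ : List Arc
    T′ = mapWith∈ kept (λ {a} a∈kept → reroute a (reachable (kept⊆T a∈kept)))

    ∈T′⁺ : ∀ {a} → a ∈ T → headV I a ≢ t → (ρ : Reach I T (tailV I a)) → reroute a ρ ∈ T′
    ∈T′⁺ {a} a∈T a↦̸t ρ = mapWith∈⁺ _ (a , a∈kept , reroute-irrelevant ρ (reachable (kept⊆T a∈kept)))
      where
      a∈kept : a ∈ kept
      a∈kept = ∈-filter⁺ (∁? intoTarget?) a∈T a↦̸t

    ∈T′⁻ : ∀ {y} → y ∈ T′ → ∃[ a ] Σ[ a∈T ∈ a ∈ T ] y ≡ reroute a (reachable a∈T)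
    ∈T′⁻ y∈T′ with mapWith∈⁻ kept _ y∈T′
    ... | a , a∈kept , y≡ = a , kept⊆T a∈kept , y≡

    unvisited-reach : ∀ {x} (ρ : Reach I T x) → visits t ρ ≡ false → Reach I T′ x
    unvisited-reach atRoot _ = atRoot
    unvisited-reach (step {a} a∈T ρ) unvisited with headV I a ≟ᵥ t
    ... | no a↦̸t = step (subst (_∈ T′) (reroute-unvisited ρ unvisited) (∈T′⁺ a∈T a↦̸t ρ))
                        (unvisited-reach ρ unvisited)

    vⁱ-reached : Reach I T′ (copy v i)
    vⁱ-reached = unvisited-reach ρ (¬-not unvisited)
      where
      ρ : Reach I T (copy v i)
      ρ = inTree⇒reach reachable vⁱ∈T
      unvisited : visits t ρ ≢ true
      unvisited vis with visits-copy d-positive ρ vis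
      ... | inj₁ vⁱ≡vʲ          = <-irrefl (proj₂ (copy-injective vⁱ≡vʲ)) i<j
      ... | inj₂ (atCopy j<i) = <-asym i<j j<i

    relocated-reach : ∀ {x} (ρ : Reach I T x) → Reach I T′ (relocate (visits t ρ) x)
    relocated-reach atRoot = atRoot
    relocated-reach (step {a} a∈T ρ) with headV I a ≟ᵥ t
    ... | yes a↦t = subst (Reach I T′) (sym shifted-t) vⁱ-reached
      where
      shifted-t : shiftV K (headV I a) ≡ copy v i
      shifted-t = trans (cong (shiftV K) a↦t) (cong (copy v) (m∸[m∸n]≡n (<⇒≤ i<j)))
    ... | no a↦̸t = subst (Reach I T′) (headV-reroute a ρ)
                     (step (∈T′⁺ a∈T a↦̸t ρ) (subst (Reach I T′) (sym (tailV-reroute a ρ)) (relocated-reach ρ)))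

    T′-isDST : IsDST I T′
    T′-isDST = unique , All.tabulate valid′ , head≢root′ , head-injective′ , reachable′ , spanning′
      where
      unique : Unique T′
      unique = mapWith∈-unique kept _
        (λ p q → reroute-injective (kept⊆T p) (kept⊆T q) (reachable (kept⊆T p)) (reachable (kept⊆T q)) ∘ cong (headV I))
        (filter⁺ (∁? intoTarget?) T!)

      valid′ : ∀ {y} → y ∈ T′ → ValidArc I y
      valid′ y∈T′ with ∈T′⁻ y∈T′
      ... | _ , a∈T , refl = validArc-reroute a∈T (reachable a∈T)

      head≢root′ : ∀ {y} → y ∈ T′ → headV I y ≢ root
      head≢root′ y∈T′ y↦root with ∈T′⁻ y∈T′
      ... | a , a∈T , refl = head≢root a∈T (relocate-root _ (trans (sym (headV-reroute a (reachable a∈T))) y↦root))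
        where
        relocate-root : ∀ moved {x} → relocate moved x ≡ root → x ≡ root
        relocate-root true  = shiftV-root _
        relocate-root false x≡root = x≡root

      head-injective′ : ∀ {y y′} → y ∈ T′ → y′ ∈ T′ → headV I y ≡ headV I y′ → y ≡ y′
      head-injective′ y∈T′ y′∈T′ eq with ∈T′⁻ y∈T′ | ∈T′⁻ y′∈T′
      ... | _ , a∈T , refl | _ , a′∈T , refl with reroute-injective a∈T a′∈T (reachable a∈T) (reachable a′∈T) eq
      ...   | refl = reroute-irrelevant (reachable a∈T) (reachable a′∈T)

      reachable′ : ∀ {y} → y ∈ T′ → Reach I T′ (tailV I y)
      reachable′ y∈T′ with ∈T′⁻ y∈T′
      ... | a , a∈T , refl = subst (Reach I T′) (sym (tailV-reroute a (reachable a∈T))) (relocated-reach (reachable a∈T))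

      spanning′ : ∀ u → u ∈ₛ S → u ≢ r → InTree I T′ (term u)
      spanning′ u u∈S u≢r with spanning u u∈S u≢r
      ... | inj₂ (a , a∈T , a↦u) = inj₂ (reroute a ρ , ∈T′⁺ a∈T a↦̸t ρ , trans (headV-reroute a ρ) (relocate-term _))
        where
        ρ : Reach I T (tailV I a)
        ρ = reachable a∈T
        a↦̸t : headV I a ≢ t
        a↦̸t a↦t with trans (sym a↦u) a↦t
        ... | ()
        relocate-term : ∀ moved → relocate moved (headV I a) ≡ term u
        relocate-term true  rewrite a↦u = refl
        relocate-term false = a↦u

    treeCost-T′ : treeCost I T′ ≡ treeCost I kept
    treeCost-T′ = begin
      sum (map (arcCost I) T′)
        ≡⟨ cong sum (map-mapWith∈ kept _ (arcCost I)) ⟩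
      sum (mapWith∈ kept (λ {a} p → arcCost I (reroute a (reachable (kept⊆T p)))))
        ≡⟨ cong sum (mapWith∈-cong kept _ _ (λ p → arcCost-reroute _ (reachable (kept⊆T p)))) ⟩
      sum (mapWith∈ kept (λ {a} _ → arcCost I a))
        ≡⟨ cong sum (mapWith∈≗map (arcCost I) kept) ⟩
      treeCost I kept
        ∎
      where open ≡-Reasoning

    T′-cheaper : treeCost I T′ < treeCost I T
    T′-cheaper = begin-strict
      treeCost I T′                               ≡⟨ treeCost-T′ ⟩
      treeCost I kept                             <⟨ m<m+n _ (arcCost-positive c-positive b b↦vʲ) ⟩
      treeCost I kept + arcCost I b               ≤⟨ +-monoʳ-≤ (treeCost I kept) (∈⇒≤sum-map (arcCost I) b∈intoTarget) ⟩
      treeCost I kept + treeCost I intoTarget     ≡⟨ +-comm (treeCost I kept) _ ⟩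
      treeCost I intoTarget + treeCost I kept     ≡⟨ sum-map-filter intoTarget? (arcCost I) T ⟨
      treeCost I T                                ∎
      where
      open ≤-Reasoning
      intoTarget : List Arc
      intoTarget = filter intoTarget? T
      b∈intoTarget : b ∈ intoTarget
      b∈intoTarget = ∈-filter⁺ intoTarget? b∈T b↦vʲ

  module _ (c-positive : ∀ e → 1 ≤ c e) (d-positive : ∀ e → 1 ≤ d e) {T : List Arc} (minimal : IsMinDST I T) where

    no-topmost-duplicate : ∀ {j} → FreeAbove T j → ¬ Duplicated T j
    no-topmost-duplicate free (v , i , i<j , vⁱ∈T , inj₂ (b , b∈T , b↦vʲ)) =
      let (T! , valid , head≢root , head-injective , reachable , spanning) , cheapest = minimal
          open Exchange c-positive d-positive T! valid head≢root head-injective reachable spanning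
                        i<j vⁱ∈T b∈T b↦vʲ free
      in <⇒≱ T′-cheaper (cheapest T′ T′-isDST)

    no-duplicate : ∀ h j → D ≤ h + j → ¬ Duplicated T j
    no-duplicate zero    j D≤j     = no-topmost-duplicate beyond-D
      where
      beyond-D : FreeAbove T j
      beyond-D j<k (_ , _ , _ , _ , uᵏ∈T) =
        let (_ , valid , _) , _ = minimal
        in <⇒≱ (≤-<-trans D≤j j<k) (proj₂ (inTree-copy-index d-positive valid uᵏ∈T))
    no-duplicate (suc h) j D≤1+h+j = no-topmost-duplicate λ {k} j<k →
      no-duplicate h k (≤-trans D≤1+h+j (≤-trans (≤-reflexive (sym (+-suc h j))) (+-monoʳ-≤ h j<k)))

    inTree-copy-index-unique : ∀ {v i j} → InTree I T (copy v i) → InTree I T (copy v j) → i ≡ j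
    inTree-copy-index-unique {v} {i} {j} vⁱ∈T vʲ∈T with <-cmp i j
    ... | tri< i<j _ _ = ⊥-elim (no-duplicate D j (m≤m+n D j) (v , i , i<j , vⁱ∈T , vʲ∈T))
    ... | tri≈ _ i≡j _ = i≡j
    ... | tri> _ _ j<i = ⊥-elim (no-duplicate D i (m≤m+n D i) (v , j , j<i , vʲ∈T , vⁱ∈T))

lemma3 : (I : Instance)
    → Instance.r I ∈ₛ Instance.S I
    → (∀ e → 1 ≤ Instance.c I e)
    → (∀ e → 1 ≤ Instance.d I e)
    → 1 ≤ Instance.D I
    → (T : List (HArc (Instance.m I) (Instance.n I)))
    → IsMinDST I T
    → (v : Fin (Instance.n I)) → v ≢ Instance.r I
    → (i j : ℕ) → 1 ≤ i → i ≤ Instance.D I → 1 ≤ j → j ≤ Instance.D I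
    → InTree I T (copy v i) → InTree I T (copy v j)
    → i ≡ j
lemma3 I _ c-positive d-positive _ T minimal v _ i j _ _ _ _ =
  inTree-copy-index-unique I c-positive d-positive minimal
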